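{- Let $v, v'$ be two distinct integers, let $p \geq \max(5, |v - v'|+1)$ be a prime, and let $\lambda \in \mathbb F_p$. Let $S= \{ T(\lambda-v), T(\lambda-v')\} \subset \operatorname{PSL}_2(p)$, where $T(\mu)$ is the image in $\operatorname{PSL}_2(p)$ of $\begin{pmatrix} \mu & -1 \\ 1 & 0\end{pmatrix}$. Then $\langle S^2S^{ -2}\rangle = \langle S^{ -2}S^{2}\rangle = \operatorname{PSL}_2(p)$.
   Context: $S^2S^{ -2}$ denotes the set of elements $g_1g_2g_3^{ -1}g_4^{ -1}$ with $g_i \in S$, and $S^{ -2}S^2$ the set of elements $g_1^{ -1}g_2^{ -1}g_3g_4$ with $g_i\in S$; $\langle X \rangle$ is the subgroup generated by $X$. -}

module Defs where

open import Data.Nat using (ℕ)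
open import Data.Integer using (ℤ; +_; -_; _-_; _*_; _+_)
open import Data.Integer.Divisibility using (_∣_)
open import Data.Product using (_×_; Σ; ∃; _,_)
open import Data.Sum using (_⊎_)

-- Congruence of integers modulo p: F_p is modelled as ℤ / pℤ.
_≡_[mod_] : ℤ → ℤ → ℕ → Set
x ≡ y [mod p ] = (+ p) ∣ (x - y)

-- 2×2 integer matrices [[a , b] , [c , d]], read modulo p.
record M₂ : Set where
  constructor mat
  field
    a b c d : ℤ
open M₂ public

_·_ : M₂ → M₂ → M₂
mat a₁ b₁ c₁ d₁ · mat a₂ b₂ c₂ d₂ =
  mat (a₁ * a₂ + b₁ * c₂) (a₁ * b₂ + b₁ * d₂) (c₁ * a₂ + d₁ * c₂) (c₁ * b₂ + d₁ * d₂)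

det : M₂ → ℤ
det (mat a b c d) = a * d - b * c

I₂ : M₂
I₂ = mat (+ 1) (+ 0) (+ 0) (+ 1)

-- adjugate; this is the inverse in SL₂ (all matrices considered have det ≡ 1 mod p)
inv : M₂ → M₂
inv (mat a b c d) = mat d (- b) (- c) a

neg : M₂ → M₂
neg (mat a b c d) = mat (- a) (- b) (- c) (- d)

_≈_[mod_] : M₂ → M₂ → ℕ → Set
A ≈ B [mod p ] =
  (a A ≡ a B [mod p ]) × (b A ≡ b B [mod p ]) × (c A ≡ c B [mod p ]) × (d A ≡ d B [mod p ])

-- equality in PSL₂(p) = SL₂(F_p)/{±I}
PSLEq : ℕ → M₂ → M₂ → Set
PSLEq p A B = (A ≈ B [mod p ]) ⊎ (A ≈ neg B [mod p ])

InSL : ℕ → M₂ → Set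
InSL p A = det A ≡ + 1 [mod p ]

-- subgroup of PSL₂(p) generated by a subset X (subsets are predicates
-- on representatives, closed under PSLEq by the 'resp' rule)
data ⟨_⟩ (p : ℕ) (X : M₂ → Set) : M₂ → Set where
  gen  : ∀ {g} → X g → ⟨ p ⟩ X g
  one  : ⟨ p ⟩ X I₂
  mul  : ∀ {g h} → ⟨ p ⟩ X g → ⟨ p ⟩ X h → ⟨ p ⟩ X (g · h)
  inv' : ∀ {g} → ⟨ p ⟩ X g → ⟨ p ⟩ X (inv g)
  resp : ∀ {g h} → PSLEq p g h → ⟨ p ⟩ X g → ⟨ p ⟩ X h

T : ℤ → M₂
T μ = mat μ (- (+ 1)) (+ 1) (+ 0)

S : ℕ → ℤ → ℤ → ℤ → M₂ → Set
S p lam v v' g = PSLEq p g (T (lam - v)) ⊎ PSLEq p g (T (lam - v'))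

S2S-2 : (M₂ → Set) → M₂ → Set
S2S-2 Y g = Σ M₂ λ g₁ → Σ M₂ λ g₂ → Σ M₂ λ g₃ → Σ M₂ λ g₄ →
  Y g₁ × Y g₂ × Y g₃ × Y g₄ × (g ≡ ((g₁ · g₂) · inv g₃) · inv g₄)
  where open import Relation.Binary.PropositionalEquality using (_≡_)

S-2S2 : (M₂ → Set) → M₂ → Set
S-2S2 Y g = Σ M₂ λ g₁ → Σ M₂ λ g₂ → Σ M₂ λ g₃ → Σ M₂ λ g₄ →
  Y g₁ × Y g₂ × Y g₃ × Y g₄ × (g ≡ ((inv g₁ · inv g₂) · g₃) · g₄)
  where open import Relation.Binary.PropositionalEquality using (_≡_)

-- Write α = λ - v and β = λ - v', so that α - β ≡ v' - v is a unit mod p. Then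
-- T α T β T β⁻¹ T β⁻¹ = U (α - β) is a nontrivial upper unipotent element of ⟨S²S⁻²⟩, hence
-- all of them lie in it, and conjugating T α T α T β⁻¹ T α⁻¹ by one of them gives the lower
-- unipotent L (β - α). Dually T β⁻¹ T α⁻¹ T α T α = L (β - α) lies in ⟨S⁻²S²⟩. Upper and lower
-- unipotents generate SL₂(F_p) by the decomposition g = U s · L c · U t (for c ≢ 0 mod p).
-- Conversely every generator has determinant 1, so both subgroups lie in SL₂(F_p).
module Submission where

open import Data.Integer as ℤ using (ℤ; +_; -[1+_]; -_; _-_; _*_; ∣_∣)
import Data.Integer.Properties as ℤ
open import Data.Integer.Divisibility.Signed
  using (_∣_; divides; _∣?_; ∣ᵤ⇒∣; ∣⇒∣ᵤ; ∣m∣n⇒∣m+n; ∣m∣n⇒∣m-n; ∣m+n∣n⇒∣m; ∣m⇒∣-m; ∣n⇒∣m*n; ∣m⇒∣m*n)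
open import Data.Integer.Solver using (module +-*-Solver)
open import Data.Integer.Tactic.RingSolver using (solve-∀)
open import Data.Nat as ℕ using (ℕ; suc; _≤_; _<_; _+_)
import Data.Nat.Properties as ℕ
import Data.Nat.Divisibility as ℕ
open import Data.Nat.Coprimality using (Coprime; coprime-Bézout)
open import Data.Nat.GCD using (module Bézout)
open import Data.Nat.Primality using (Prime; prime⇒irreducible; ¬prime[1])
open import Data.Product using (_×_; _,_; ∃)
open import Data.Sum using (inj₁; inj₂)
open import Function using (_∘_)
open import Relation.Binary.PropositionalEquality
  using (_≡_; _≢_; refl; sym; trans; cong; subst; ≢-sym)
open import Relation.Nullary using (¬_; yes; no; contradiction)

open import Defs
open +-*-Solver using (solve; _:=_; Polynomial; con; _:+_; _:*_; _:-_; :-_)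

U L : ℤ → M₂
U t = mat (+ 1) t (+ 0) (+ 1)
L t = mat (+ 1) (+ 0) t (+ 1)

mat-cong : ∀ {a₁ b₁ c₁ d₁ a₂ b₂ c₂ d₂} → a₁ ≡ a₂ → b₁ ≡ b₂ → c₁ ≡ c₂ → d₁ ≡ d₂ →
  mat a₁ b₁ c₁ d₁ ≡ mat a₂ b₂ c₂ d₂
mat-cong refl refl refl refl = refl

-- Matrices of polynomials: the ring solver proves matrix identities one entry at a time.
record M₂ᴾ (n : ℕ) : Set where
  constructor matᴾ
  field aᴾ bᴾ cᴾ dᴾ : Polynomial n
open M₂ᴾ

_·ᴾ_ : ∀ {n} → M₂ᴾ n → M₂ᴾ n → M₂ᴾ n
matᴾ a₁ b₁ c₁ d₁ ·ᴾ matᴾ a₂ b₂ c₂ d₂ =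
  matᴾ (a₁ :* a₂ :+ b₁ :* c₂) (a₁ :* b₂ :+ b₁ :* d₂) (c₁ :* a₂ :+ d₁ :* c₂) (c₁ :* b₂ :+ d₁ :* d₂)

invᴾ : ∀ {n} → M₂ᴾ n → M₂ᴾ n
invᴾ (matᴾ a₁ b₁ c₁ d₁) = matᴾ d₁ (:- b₁) (:- c₁) a₁

detᴾ : ∀ {n} → M₂ᴾ n → Polynomial n
detᴾ (matᴾ a₁ b₁ c₁ d₁) = a₁ :* d₁ :- b₁ :* c₁

Uᴾ Lᴾ Tᴾ : ∀ {n} → Polynomial n → M₂ᴾ n
Uᴾ t = matᴾ (con (+ 1)) t (con (+ 0)) (con (+ 1))
Lᴾ t = matᴾ (con (+ 1)) (con (+ 0)) t (con (+ 1))
Tᴾ μ = matᴾ μ (:- con (+ 1)) (con (+ 1)) (con (+ 0))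

det-· : ∀ A B → det (A · B) ≡ det A * det B
det-· (mat a₁ b₁ c₁ d₁) (mat a₂ b₂ c₂ d₂) =
  solve 8 (λ a₁ b₁ c₁ d₁ a₂ b₂ c₂ d₂ →
    detᴾ (matᴾ a₁ b₁ c₁ d₁ ·ᴾ matᴾ a₂ b₂ c₂ d₂) := detᴾ (matᴾ a₁ b₁ c₁ d₁) :* detᴾ (matᴾ a₂ b₂ c₂ d₂))
    refl a₁ b₁ c₁ d₁ a₂ b₂ c₂ d₂

det-inv : ∀ A → det (inv A) ≡ det A
det-inv (mat a₁ b₁ c₁ d₁) = identity a₁ b₁ c₁ d₁
  where
  identity : ∀ a b c d → d * a - (- b) * (- c) ≡ a * d - b * c
  identity = solve-∀

det-neg : ∀ A → det (neg A) ≡ det A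
det-neg (mat a₁ b₁ c₁ d₁) = identity a₁ b₁ c₁ d₁
  where
  identity : ∀ a b c d → (- a) * (- d) - (- b) * (- c) ≡ a * d - b * c
  identity = solve-∀

det-T : ∀ μ → det (T μ) ≡ + 1
det-T = solve 1 (λ μ → detᴾ (Tᴾ μ) := con (+ 1)) refl

U-+ : ∀ x y → U x · U y ≡ U (x ℤ.+ y)
U-+ x y = mat-cong (solve 2 (λ x y → aᴾ (Uᴾ x ·ᴾ Uᴾ y) := con (+ 1)) refl x y)
                   (solve 2 (λ x y → bᴾ (Uᴾ x ·ᴾ Uᴾ y) := x :+ y) refl x y)
                   (solve 2 (λ x y → cᴾ (Uᴾ x ·ᴾ Uᴾ y) := con (+ 0)) refl x y)
                   (solve 2 (λ x y → dᴾ (Uᴾ x ·ᴾ Uᴾ y) := con (+ 1)) refl x y)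

L-+ : ∀ x y → L x · L y ≡ L (x ℤ.+ y)
L-+ x y = mat-cong (solve 2 (λ x y → aᴾ (Lᴾ x ·ᴾ Lᴾ y) := con (+ 1)) refl x y)
                   (solve 2 (λ x y → bᴾ (Lᴾ x ·ᴾ Lᴾ y) := con (+ 0)) refl x y)
                   (solve 2 (λ x y → cᴾ (Lᴾ x ·ᴾ Lᴾ y) := x :+ y) refl x y)
                   (solve 2 (λ x y → dᴾ (Lᴾ x ·ᴾ Lᴾ y) := con (+ 1)) refl x y)

L-cancelˡ : ∀ t A → L (- t) · (L t · A) ≡ A
L-cancelˡ t (mat a₀ b₀ c₀ d₀) =
  mat-cong (solve 5 (λ t a b c d → aᴾ (lhs t a b c d) := a) refl t a₀ b₀ c₀ d₀)
           (solve 5 (λ t a b c d → bᴾ (lhs t a b c d) := b) refl t a₀ b₀ c₀ d₀)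
           (solve 5 (λ t a b c d → cᴾ (lhs t a b c d) := c) refl t a₀ b₀ c₀ d₀)
           (solve 5 (λ t a b c d → dᴾ (lhs t a b c d) := d) refl t a₀ b₀ c₀ d₀)
  where
  lhs : ∀ {n} → (t a b c d : Polynomial n) → M₂ᴾ n
  lhs t a b c d = Lᴾ (:- t) ·ᴾ (Lᴾ t ·ᴾ matᴾ a b c d)

-- With w = T (+ 0) we have T α = U α · w = w · L (- α), so the conjugations below reduce to
-- w U t w⁻¹ = L (- t) and w⁻¹ L t w = U (- t).
T-T-T⁻¹-T⁻¹ : ∀ α β → ((T α · T β) · inv (T β)) · inv (T β) ≡ U (α - β)
T-T-T⁻¹-T⁻¹ α β =
  mat-cong (solve 2 (λ x y → aᴾ (lhs x y) := aᴾ (Uᴾ (x :- y))) refl α β)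
           (solve 2 (λ x y → bᴾ (lhs x y) := bᴾ (Uᴾ (x :- y))) refl α β)
           (solve 2 (λ x y → cᴾ (lhs x y) := cᴾ (Uᴾ (x :- y))) refl α β)
           (solve 2 (λ x y → dᴾ (lhs x y) := dᴾ (Uᴾ (x :- y))) refl α β)
  where
  lhs : ∀ {n} → Polynomial n → Polynomial n → M₂ᴾ n
  lhs x y = ((Tᴾ x ·ᴾ Tᴾ y) ·ᴾ invᴾ (Tᴾ y)) ·ᴾ invᴾ (Tᴾ y)

U-conj-T-T-T⁻¹-T⁻¹ : ∀ α β → (U (- α) · (((T α · T α) · inv (T β)) · inv (T α))) · U α ≡ L (β - α)
U-conj-T-T-T⁻¹-T⁻¹ α β =
  mat-cong (solve 2 (λ x y → aᴾ (lhs x y) := aᴾ (Lᴾ (y :- x))) refl α β)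
           (solve 2 (λ x y → bᴾ (lhs x y) := bᴾ (Lᴾ (y :- x))) refl α β)
           (solve 2 (λ x y → cᴾ (lhs x y) := cᴾ (Lᴾ (y :- x))) refl α β)
           (solve 2 (λ x y → dᴾ (lhs x y) := dᴾ (Lᴾ (y :- x))) refl α β)
  where
  lhs : ∀ {n} → Polynomial n → Polynomial n → M₂ᴾ n
  lhs x y = (Uᴾ (:- x) ·ᴾ (((Tᴾ x ·ᴾ Tᴾ x) ·ᴾ invᴾ (Tᴾ y)) ·ᴾ invᴾ (Tᴾ x))) ·ᴾ Uᴾ x

T⁻¹-T⁻¹-T-T : ∀ α β → ((inv (T β) · inv (T α)) · T α) · T α ≡ L (β - α)
T⁻¹-T⁻¹-T-T α β =
  mat-cong (solve 2 (λ x y → aᴾ (lhs x y) := aᴾ (Lᴾ (y :- x))) refl α β)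
           (solve 2 (λ x y → bᴾ (lhs x y) := bᴾ (Lᴾ (y :- x))) refl α β)
           (solve 2 (λ x y → cᴾ (lhs x y) := cᴾ (Lᴾ (y :- x))) refl α β)
           (solve 2 (λ x y → dᴾ (lhs x y) := dᴾ (Lᴾ (y :- x))) refl α β)
  where
  lhs : ∀ {n} → Polynomial n → Polynomial n → M₂ᴾ n
  lhs x y = ((invᴾ (Tᴾ y) ·ᴾ invᴾ (Tᴾ x)) ·ᴾ Tᴾ x) ·ᴾ Tᴾ x

L-conj-T⁻¹-T⁻¹-T-T : ∀ α β → (L (- α) · (((inv (T α) · inv (T β)) · T α) · T α)) · L α ≡ U (α - β)
L-conj-T⁻¹-T⁻¹-T-T α β =
  mat-cong (solve 2 (λ x y → aᴾ (lhs x y) := aᴾ (Uᴾ (x :- y))) refl α β)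
           (solve 2 (λ x y → bᴾ (lhs x y) := bᴾ (Uᴾ (x :- y))) refl α β)
           (solve 2 (λ x y → cᴾ (lhs x y) := cᴾ (Uᴾ (x :- y))) refl α β)
           (solve 2 (λ x y → dᴾ (lhs x y) := dᴾ (Uᴾ (x :- y))) refl α β)
  where
  lhs : ∀ {n} → Polynomial n → Polynomial n → M₂ᴾ n
  lhs x y = (Lᴾ (:- x) ·ᴾ (((invᴾ (Tᴾ x) ·ᴾ invᴾ (Tᴾ y)) ·ᴾ Tᴾ x) ·ᴾ Tᴾ x)) ·ᴾ Lᴾ x

module Congruence (p : ℕ) where

  infix 4 _≡ₚ_ _≈ₚ_

  record _≡ₚ_ (x y : ℤ) : Set where
    constructor congruent
    field p∣x-y : + p ∣ x - y
  open _≡ₚ_ public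

  ≡ₚ-from : ∀ {x y} e → x - y ≡ e → + p ∣ e → x ≡ₚ y
  ≡ₚ-from e x-y≡e p∣e = congruent (subst (+ p ∣_) (sym x-y≡e) p∣e)

  ≡⇒≡ₚ : ∀ {x y} → x ≡ y → x ≡ₚ y
  ≡⇒≡ₚ {x} refl = ≡ₚ-from (+ 0) (ℤ.+-inverseʳ x) (divides (+ 0) refl)

  ≡ₚ-refl : ∀ {x} → x ≡ₚ x
  ≡ₚ-refl = ≡⇒≡ₚ refl

  ≡ₚ-sym : ∀ {x y} → x ≡ₚ y → y ≡ₚ x
  ≡ₚ-sym {x} {y} (congruent h) = ≡ₚ-from _ (identity x y) (∣m⇒∣-m h)
    where
    identity : ∀ x y → y - x ≡ - (x - y)
    identity = solve-∀

  ≡ₚ-trans : ∀ {x y z} → x ≡ₚ y → y ≡ₚ z → x ≡ₚ z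
  ≡ₚ-trans {x} {y} {z} (congruent h) (congruent k) = ≡ₚ-from _ (identity x y z) (∣m∣n⇒∣m+n h k)
    where
    identity : ∀ x y z → x - z ≡ (x - y) ℤ.+ (y - z)
    identity = solve-∀

  +-cong : ∀ {x y u w} → x ≡ₚ y → u ≡ₚ w → x ℤ.+ u ≡ₚ y ℤ.+ w
  +-cong {x} {y} {u} {w} (congruent h) (congruent k) = ≡ₚ-from _ (identity x y u w) (∣m∣n⇒∣m+n h k)
    where
    identity : ∀ x y u w → (x ℤ.+ u) - (y ℤ.+ w) ≡ (x - y) ℤ.+ (u - w)
    identity = solve-∀

  *-cong : ∀ {x y u w} → x ≡ₚ y → u ≡ₚ w → x * u ≡ₚ y * w
  *-cong {x} {y} {u} {w} (congruent h) (congruent k) =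
    ≡ₚ-from _ (identity x y u w) (∣m∣n⇒∣m+n (∣n⇒∣m*n u h) (∣n⇒∣m*n y k))
    where
    identity : ∀ x y u w → x * u - y * w ≡ u * (x - y) ℤ.+ y * (u - w)
    identity = solve-∀

  -‿cong : ∀ {x y} → x ≡ₚ y → - x ≡ₚ - y
  -‿cong {x} {y} (congruent h) = ≡ₚ-from _ (identity x y) (∣m⇒∣-m h)
    where
    identity : ∀ x y → - x - - y ≡ - (x - y)
    identity = solve-∀

  _≈ₚ_ : M₂ → M₂ → Set
  A ≈ₚ B = (a A ≡ₚ a B) × (b A ≡ₚ b B) × (c A ≡ₚ c B) × (d A ≡ₚ d B)

  [mod]⇒≈ₚ : ∀ {A B} → A ≈ B [mod p ] → A ≈ₚ B
  [mod]⇒≈ₚ (ha , hb , hc , hd) =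
    congruent (∣ᵤ⇒∣ ha) , congruent (∣ᵤ⇒∣ hb) , congruent (∣ᵤ⇒∣ hc) , congruent (∣ᵤ⇒∣ hd)

  ≈ₚ⇒PSLEq : ∀ {A B} → A ≈ₚ B → PSLEq p A B
  ≈ₚ⇒PSLEq (ha , hb , hc , hd) =
    inj₁ (∣⇒∣ᵤ (p∣x-y ha) , ∣⇒∣ᵤ (p∣x-y hb) , ∣⇒∣ᵤ (p∣x-y hc) , ∣⇒∣ᵤ (p∣x-y hd))

  PSLEq-refl : ∀ {A} → PSLEq p A A
  PSLEq-refl {A} = ≈ₚ⇒PSLEq {A} (≡ₚ-refl , ≡ₚ-refl , ≡ₚ-refl , ≡ₚ-refl)

  det-cong : ∀ {A B} → A ≈ₚ B → det A ≡ₚ det B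
  det-cong (ha , hb , hc , hd) = +-cong (*-cong ha hd) (-‿cong (*-cong hb hc))

  PSLEq⇒det≡ₚ : ∀ {A B} → PSLEq p A B → det A ≡ₚ det B
  PSLEq⇒det≡ₚ {A} {B} (inj₁ A≈B) = det-cong {A} {B} ([mod]⇒≈ₚ A≈B)
  PSLEq⇒det≡ₚ {A} {B} (inj₂ A≈-B) = ≡ₚ-trans (det-cong {A} {neg B} ([mod]⇒≈ₚ A≈-B)) (≡⇒≡ₚ (det-neg B))

  record SL (g : M₂) : Set where
    constructor det≡ₚ1
    field det≡1 : det g ≡ₚ + 1
  open SL

  InSL⇒SL : ∀ {g} → InSL p g → SL g
  InSL⇒SL = det≡ₚ1 ∘ congruent ∘ ∣ᵤ⇒∣

  SL⇒InSL : ∀ {g} → SL g → InSL p g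
  SL⇒InSL = ∣⇒∣ᵤ ∘ p∣x-y ∘ det≡1

  SL-· : ∀ {A B} → SL A → SL B → SL (A · B)
  SL-· {A} {B} (det≡ₚ1 hA) (det≡ₚ1 hB) = det≡ₚ1 (≡ₚ-trans (≡⇒≡ₚ (det-· A B)) (*-cong hA hB))

  SL-inv : ∀ {A} → SL A → SL (inv A)
  SL-inv {A} (det≡ₚ1 hA) = det≡ₚ1 (≡ₚ-trans (≡⇒≡ₚ (det-inv A)) hA)

  SL-cong : ∀ {A B} → PSLEq p A B → SL A → SL B
  SL-cong {A} {B} A~B (det≡ₚ1 hA) = det≡ₚ1 (≡ₚ-trans (≡ₚ-sym (PSLEq⇒det≡ₚ {A} {B} A~B)) hA)

  ⟨⟩⊆SL : ∀ {X} → (∀ {g} → X g → SL g) → ∀ {g} → ⟨ p ⟩ X g → SL g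
  ⟨⟩⊆SL X⊆SL (gen x) = X⊆SL x
  ⟨⟩⊆SL X⊆SL one = det≡ₚ1 ≡ₚ-refl
  ⟨⟩⊆SL X⊆SL (mul g h) = SL-· (⟨⟩⊆SL X⊆SL g) (⟨⟩⊆SL X⊆SL h)
  ⟨⟩⊆SL X⊆SL (inv' g) = SL-inv (⟨⟩⊆SL X⊆SL g)
  ⟨⟩⊆SL X⊆SL (resp g~h g) = SL-cong g~h (⟨⟩⊆SL X⊆SL g)

  S2S-2⊆SL : ∀ {Y} → (∀ {g} → Y g → SL g) → ∀ {g} → S2S-2 Y g → SL g
  S2S-2⊆SL Y⊆SL (_ , _ , _ , _ , y₁ , y₂ , y₃ , y₄ , refl) =
    SL-· (SL-· (SL-· (Y⊆SL y₁) (Y⊆SL y₂)) (SL-inv (Y⊆SL y₃))) (SL-inv (Y⊆SL y₄))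

  S-2S2⊆SL : ∀ {Y} → (∀ {g} → Y g → SL g) → ∀ {g} → S-2S2 Y g → SL g
  S-2S2⊆SL Y⊆SL (_ , _ , _ , _ , y₁ , y₂ , y₃ , y₄ , refl) =
    SL-· (SL-· (SL-· (SL-inv (Y⊆SL y₁)) (SL-inv (Y⊆SL y₂))) (Y⊆SL y₃)) (Y⊆SL y₄)

  PSLEq-T⇒SL : ∀ {g} μ → PSLEq p g (T μ) → SL g
  PSLEq-T⇒SL {g} μ g~T = det≡ₚ1 (≡ₚ-trans (PSLEq⇒det≡ₚ {g} {T μ} g~T) (≡⇒≡ₚ (det-T μ)))

  S⊆SL : ∀ lam v v' {g} → S p lam v v' g → SL g
  S⊆SL lam v v' (inj₁ g~T) = PSLEq-T⇒SL (lam - v) g~T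
  S⊆SL lam v v' (inj₂ g~T) = PSLEq-T⇒SL (lam - v') g~T

  ⟨⟩-cong : ∀ {X A B} → A ≈ₚ B → ⟨ p ⟩ X A → ⟨ p ⟩ X B
  ⟨⟩-cong = resp ∘ ≈ₚ⇒PSLEq

  U-cong : ∀ {x y} → x ≡ₚ y → U x ≈ₚ U y
  U-cong x≡y = ≡ₚ-refl , x≡y , ≡ₚ-refl , ≡ₚ-refl

  L-cong : ∀ {x y} → x ≡ₚ y → L x ≈ₚ L y
  L-cong x≡y = ≡ₚ-refl , ≡ₚ-refl , x≡y , ≡ₚ-refl

  p∤difference : ∀ {x y} → x ≢ y → ∣ x - y ∣ < p → ¬ + p ∣ x - y
  p∤difference {x} {y} x≢y ∣x-y∣<p p∣x-y = ℕ.>⇒∤ {{nonZero}} ∣x-y∣<p (∣⇒∣ᵤ p∣x-y)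
    where
    nonZero : ℕ.NonZero ∣ x - y ∣
    nonZero = ℕ.≢-nonZero (x≢y ∘ ℤ.i-j≡0⇒i≡j x y ∘ ℤ.∣i∣≡0⇒i≡0)

  -- U s · L c · U t = [[1 + s c , s + t + s c t] , [c , 1 + c t]]; taking s = (a - 1) c⁻¹ and
  -- t = (d - 1) c⁻¹ matches a, c and d, and then also b because the determinant is 1.
  U-L-U-decomposition : ∀ {a₀ b₀ c₀ d₀ c'} → det (mat a₀ b₀ c₀ d₀) ≡ₚ + 1 → c₀ * c' ≡ₚ + 1 →
    (U ((a₀ - + 1) * c') · L c₀) · U ((d₀ - + 1) * c') ≈ₚ mat a₀ b₀ c₀ d₀
  U-L-U-decomposition {a₀} {b₀} {c₀} {d₀} {c'} (congruent p∣det-1) (congruent p∣cc'-1) =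
      ≡ₚ-from _ a-entry (∣n⇒∣m*n (a₀ - + 1) p∣cc'-1)
    , ≡ₚ-from _ b-entry
        (∣m∣n⇒∣m+n (∣m∣n⇒∣m+n (∣n⇒∣m*n ((a₀ - + 1) * (d₀ - + 1) * c') p∣cc'-1) (∣n⇒∣m*n c' p∣det-1))
                   (∣n⇒∣m*n b₀ p∣cc'-1))
    , ≡⇒≡ₚ c-entry
    , ≡ₚ-from _ d-entry (∣n⇒∣m*n (d₀ - + 1) p∣cc'-1)
    where
    Q : M₂
    Q = (U ((a₀ - + 1) * c') · L c₀) · U ((d₀ - + 1) * c')

    Qᴾ : ∀ {n} → (a c d c' : Polynomial n) → M₂ᴾ n
    Qᴾ a c d c' = (Uᴾ ((a :- con (+ 1)) :* c') ·ᴾ Lᴾ c) ·ᴾ Uᴾ ((d :- con (+ 1)) :* c')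

    a-entry : a Q - a₀ ≡ (a₀ - + 1) * (c₀ * c' - + 1)
    a-entry = solve 4 (λ a c d c' →
      aᴾ (Qᴾ a c d c') :- a := (a :- con (+ 1)) :* (c :* c' :- con (+ 1))) refl a₀ c₀ d₀ c'

    b-entry : b Q - b₀ ≡ (a₀ - + 1) * (d₀ - + 1) * c' * (c₀ * c' - + 1)
                           ℤ.+ c' * (det (mat a₀ b₀ c₀ d₀) - + 1) ℤ.+ b₀ * (c₀ * c' - + 1)
    b-entry = solve 5 (λ a b c d c' →
      bᴾ (Qᴾ a c d c') :- b := (a :- con (+ 1)) :* (d :- con (+ 1)) :* c' :* (c :* c' :- con (+ 1))
                             :+ c' :* (detᴾ (matᴾ a b c d) :- con (+ 1)) :+ b :* (c :* c' :- con (+ 1)))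
      refl a₀ b₀ c₀ d₀ c'

    c-entry : c Q ≡ c₀
    c-entry = solve 4 (λ a c d c' → cᴾ (Qᴾ a c d c') := c) refl a₀ c₀ d₀ c'

    d-entry : d Q - d₀ ≡ (d₀ - + 1) * (c₀ * c' - + 1)
    d-entry = solve 4 (λ a c d c' →
      dᴾ (Qᴾ a c d c') :- d := (d :- con (+ 1)) :* (c :* c' :- con (+ 1))) refl a₀ c₀ d₀ c'

ℕ-Bézout⇒ℤ : ∀ d m n x y → d + y ℕ.* n ≡ x ℕ.* m → + d ℤ.+ + y * + n ≡ + x * + m
ℕ-Bézout⇒ℤ d m n x y eq =
  trans (cong (ℤ._+_ (+ d)) (sym (ℤ.pos-* y n))) (trans (cong +_ eq) (ℤ.pos-* x m))

module _ {p : ℕ} (p-prime : Prime p) where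
  open Congruence p

  p∤1 : ¬ + p ∣ + 1
  p∤1 p∣1 = ¬prime[1] (subst Prime (ℕ.∣1⇒≡1 (∣⇒∣ᵤ p∣1)) p-prime)

  p∤⇒coprime : ∀ {n} → ¬ p ℕ.∣ n → Coprime p n
  p∤⇒coprime p∤n (d∣p , d∣n) with prime⇒irreducible p-prime d∣p
  ... | inj₁ d≡1 = d≡1
  ... | inj₂ refl = contradiction d∣n p∤n

  ℕ-inverse : ∀ n → ¬ p ℕ.∣ n → ∃ λ y → + n * y ≡ₚ + 1
  ℕ-inverse n p∤n with coprime-Bézout (p∤⇒coprime p∤n)
  ... | Bézout.+- x y 1+yn≡xp = - + y , ≡ₚ-from _ n[-y]-1≡-xp (∣m⇒∣-m (divides (+ x) refl))
    where
    identity : ∀ n y → n * - y - + 1 ≡ - (+ 1 ℤ.+ y * n)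
    identity = solve-∀
    n[-y]-1≡-xp : + n * - + y - + 1 ≡ - (+ x * + p)
    n[-y]-1≡-xp = trans (identity (+ n) (+ y)) (cong -_ (ℕ-Bézout⇒ℤ 1 p n x y 1+yn≡xp))
  ... | Bézout.-+ x y 1+xp≡yn = + y , ≡ₚ-from _ ny-1≡xp (divides (+ x) refl)
    where
    identity : ∀ q → (+ 1 ℤ.+ q) - + 1 ≡ q
    identity = solve-∀
    ny≡1+xp : + n * + y ≡ + 1 ℤ.+ + x * + p
    ny≡1+xp = trans (ℤ.*-comm (+ n) (+ y)) (sym (ℕ-Bézout⇒ℤ 1 n p y x 1+xp≡yn))
    ny-1≡xp : + n * + y - + 1 ≡ + x * + p
    ny-1≡xp = trans (cong (_- + 1) ny≡1+xp) (identity (+ x * + p))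

  inverse : ∀ x → ¬ + p ∣ x → ∃ λ y → x * y ≡ₚ + 1
  inverse (+ n) p∤x = ℕ-inverse n (p∤x ∘ ∣ᵤ⇒∣)
  inverse -[1+ m ] p∤x with ℕ-inverse (suc m) (p∤x ∘ ∣ᵤ⇒∣)
  ... | y , [1+m]y≡1 = - y , ≡ₚ-trans (≡⇒≡ₚ (identity (+ suc m) y)) [1+m]y≡1
    where
    identity : ∀ i j → - i * - j ≡ i * j
    identity = solve-∀

  SL⇒first-column≢0 : ∀ {g} → SL g → + p ∣ a g → ¬ + p ∣ c g
  SL⇒first-column≢0 {g} (det≡ₚ1 (congruent p∣det-1)) p∣a p∣c =
    p∤1 (subst (+ p ∣_) (identity (det g) (+ 1)) (∣m∣n⇒∣m-n p∣det p∣det-1))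
    where
    p∣det : + p ∣ det g
    p∣det = ∣m∣n⇒∣m-n (∣m⇒∣m*n (d g) p∣a) (∣n⇒∣m*n (b g) p∣c)
    identity : ∀ x y → x - (x - y) ≡ y
    identity = solve-∀

  module _ {X : M₂ → Set} where

    module OneParameter (E : ℤ → M₂) (E-0 : E (+ 0) ≡ I₂) (E-+ : ∀ x y → E x · E y ≡ E (x ℤ.+ y))
      (E-inv : ∀ x → inv (E x) ≡ E (- x)) (E-cong : ∀ {x y} → x ≡ₚ y → E x ≈ₚ E y)
      {u : ℤ} (Eu∈⟨X⟩ : ⟨ p ⟩ X (E u)) where

      E[n*u]∈⟨X⟩ : ∀ n → ⟨ p ⟩ X (E (+ n * u))
      E[n*u]∈⟨X⟩ ℕ.zero = subst (⟨ p ⟩ X) (sym E-0) one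
      E[n*u]∈⟨X⟩ (suc n) = subst (⟨ p ⟩ X) (trans (E-+ u (+ n * u)) (cong E (sym (ℤ.suc-* (+ n) u))))
                                (mul Eu∈⟨X⟩ (E[n*u]∈⟨X⟩ n))

      E[k*u]∈⟨X⟩ : ∀ k → ⟨ p ⟩ X (E (k * u))
      E[k*u]∈⟨X⟩ (+ n) = E[n*u]∈⟨X⟩ n
      E[k*u]∈⟨X⟩ -[1+ n ] = subst (⟨ p ⟩ X) (trans (E-inv _) (cong E (ℤ.neg-distribˡ-* (+ suc n) u)))
                                 (inv' (E[n*u]∈⟨X⟩ (suc n)))

      E∈⟨X⟩ : ¬ + p ∣ u → ∀ t → ⟨ p ⟩ X (E t)
      E∈⟨X⟩ p∤u t with inverse u p∤u
      ... | u' , congruent p∣uu'-1 =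
        ⟨⟩-cong {X} (E-cong (≡ₚ-from _ (identity t u u') (∣n⇒∣m*n t p∣uu'-1))) (E[k*u]∈⟨X⟩ (t * u'))
        where
        identity : ∀ t u u' → t * u' * u - t ≡ t * (u * u' - + 1)
        identity = solve-∀

    all-U∈⟨⟩ : ∀ {u} → ¬ + p ∣ u → ⟨ p ⟩ X (U u) → ∀ t → ⟨ p ⟩ X (U t)
    all-U∈⟨⟩ p∤u Uu∈⟨X⟩ = OneParameter.E∈⟨X⟩ U refl U-+ (λ _ → refl) U-cong Uu∈⟨X⟩ p∤u

    all-L∈⟨⟩ : ∀ {u} → ¬ + p ∣ u → ⟨ p ⟩ X (L u) → ∀ t → ⟨ p ⟩ X (L t)
    all-L∈⟨⟩ p∤u Lu∈⟨X⟩ = OneParameter.E∈⟨X⟩ L refl L-+ (λ _ → refl) L-cong Lu∈⟨X⟩ p∤u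

    module _ (U∈⟨X⟩ : ∀ t → ⟨ p ⟩ X (U t)) (L∈⟨X⟩ : ∀ t → ⟨ p ⟩ X (L t)) where

      SL[c≢0]⊆⟨U,L⟩ : ∀ {g} → SL g → ¬ + p ∣ c g → ⟨ p ⟩ X g
      SL[c≢0]⊆⟨U,L⟩ {mat a₀ b₀ c₀ d₀} (det≡ₚ1 det≡1) p∤c with inverse c₀ p∤c
      ... | c' , cc'≡1 =
        ⟨⟩-cong {X} (U-L-U-decomposition det≡1 cc'≡1)
          (mul (mul (U∈⟨X⟩ ((a₀ - + 1) * c')) (L∈⟨X⟩ c₀)) (U∈⟨X⟩ ((d₀ - + 1) * c')))

      -- If c ≡ 0 then a ≢ 0, so L 1 · g has lower-left entry a + c ≢ 0.
      SL⊆⟨U,L⟩ : ∀ {g} → SL g → ⟨ p ⟩ X g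
      SL⊆⟨U,L⟩ {g} g∈SL with + p ∣? c g
      ... | no p∤c = SL[c≢0]⊆⟨U,L⟩ g∈SL p∤c
      ... | yes p∣c = subst (⟨ p ⟩ X) (L-cancelˡ (+ 1) g)
                        (mul (L∈⟨X⟩ (- + 1)) (SL[c≢0]⊆⟨U,L⟩ (SL-· {L (+ 1)} (det≡ₚ1 ≡ₚ-refl) g∈SL) p∤a+c))
        where
        p∤a+c : ¬ + p ∣ c (L (+ 1) · g)
        p∤a+c p∣a+c = SL⇒first-column≢0 g∈SL
          (subst (+ p ∣_) (ℤ.*-identityˡ (a g)) (∣m+n∣n⇒∣m p∣a+c (∣n⇒∣m*n (+ 1) p∣c))) p∣c

  module _ (lam v v' : ℤ) (v≢v' : v ≢ v') (∣v-v'∣<p : ∣ v - v' ∣ < p) where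
    private
      α β : ℤ
      α = lam - v
      β = lam - v'

      Tα∈S : S p lam v v' (T α)
      Tα∈S = inj₁ (PSLEq-refl {T α})

      Tβ∈S : S p lam v v' (T β)
      Tβ∈S = inj₂ (PSLEq-refl {T β})

      difference : ∀ l x y → (l - y) - (l - x) ≡ x - y
      difference = solve-∀

      p∤β-α : ¬ + p ∣ β - α
      p∤β-α = subst (λ z → ¬ + p ∣ z) (sym (difference lam v v')) (p∤difference v≢v' ∣v-v'∣<p)

      p∤α-β : ¬ + p ∣ α - β
      p∤α-β = subst (λ z → ¬ + p ∣ z) (sym (difference lam v' v))
        (p∤difference (≢-sym v≢v') (subst (_< p) (ℤ.∣i-j∣≡∣j-i∣ v v') ∣v-v'∣<p))

    SL⊆⟨S²S⁻²⟩ : ∀ {g} → SL g → ⟨ p ⟩ (S2S-2 (S p lam v v')) g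
    SL⊆⟨S²S⁻²⟩ = SL⊆⟨U,L⟩ U∈⟨X⟩ L∈⟨X⟩
      where
      U∈⟨X⟩ : ∀ t → ⟨ p ⟩ (S2S-2 (S p lam v v')) (U t)
      U∈⟨X⟩ = all-U∈⟨⟩ p∤α-β (subst (⟨ p ⟩ _) (T-T-T⁻¹-T⁻¹ α β)
        (gen (T α , T β , T β , T β , Tα∈S , Tβ∈S , Tβ∈S , Tβ∈S , refl)))

      L∈⟨X⟩ : ∀ t → ⟨ p ⟩ (S2S-2 (S p lam v v')) (L t)
      L∈⟨X⟩ = all-L∈⟨⟩ p∤β-α (subst (⟨ p ⟩ _) (U-conj-T-T-T⁻¹-T⁻¹ α β)
        (mul (mul (U∈⟨X⟩ (- α)) (gen (T α , T α , T β , T α , Tα∈S , Tα∈S , Tβ∈S , Tα∈S , refl))) (U∈⟨X⟩ α)))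

    SL⊆⟨S⁻²S²⟩ : ∀ {g} → SL g → ⟨ p ⟩ (S-2S2 (S p lam v v')) g
    SL⊆⟨S⁻²S²⟩ = SL⊆⟨U,L⟩ U∈⟨X⟩ L∈⟨X⟩
      where
      L∈⟨X⟩ : ∀ t → ⟨ p ⟩ (S-2S2 (S p lam v v')) (L t)
      L∈⟨X⟩ = all-L∈⟨⟩ p∤β-α (subst (⟨ p ⟩ _) (T⁻¹-T⁻¹-T-T α β)
        (gen (T β , T α , T α , T α , Tβ∈S , Tα∈S , Tα∈S , Tα∈S , refl)))

      U∈⟨X⟩ : ∀ t → ⟨ p ⟩ (S-2S2 (S p lam v v')) (U t)
      U∈⟨X⟩ = all-U∈⟨⟩ p∤α-β (subst (⟨ p ⟩ _) (L-conj-T⁻¹-T⁻¹-T-T α β)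
        (mul (mul (L∈⟨X⟩ (- α)) (gen (T α , T β , T α , T α , Tα∈S , Tβ∈S , Tα∈S , Tα∈S , refl))) (L∈⟨X⟩ α)))

lemma5 : (v v' : ℤ) → v ≢ v' → (p : ℕ) → Prime p → 5 ≤ p → ∣ v - v' ∣ + 1 ≤ p →
    (lam : ℤ) →
    (∀ g → InSL p g → ⟨ p ⟩ (S2S-2 (S p lam v v')) g)
    × (∀ g → ⟨ p ⟩ (S2S-2 (S p lam v v')) g → InSL p g)
    × (∀ g → InSL p g → ⟨ p ⟩ (S-2S2 (S p lam v v')) g)
    × (∀ g → ⟨ p ⟩ (S-2S2 (S p lam v v')) g → InSL p g)
lemma5 v v' v≢v' p p-prime _ ∣v-v'∣+1≤p lam =
    (λ _ → SL⊆⟨S²S⁻²⟩ p-prime lam v v' v≢v' ∣v-v'∣<p ∘ InSL⇒SL)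
  , (λ _ → SL⇒InSL ∘ ⟨⟩⊆SL (S2S-2⊆SL (S⊆SL lam v v')))
  , (λ _ → SL⊆⟨S⁻²S²⟩ p-prime lam v v' v≢v' ∣v-v'∣<p ∘ InSL⇒SL)
  , (λ _ → SL⇒InSL ∘ ⟨⟩⊆SL (S-2S2⊆SL (S⊆SL lam v v')))
  where
  open Congruence p
  ∣v-v'∣<p : ∣ v - v' ∣ < p
  ∣v-v'∣<p = subst (_≤ p) (ℕ.+-comm ∣ v - v' ∣ 1) ∣v-v'∣+1≤p
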